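{- Each of the following four graphs is a minimal unsatisfiability graph: (1) two triangles sharing exactly one vertex; (2) two vertex-disjoint triangles together with a single edge joining a vertex of one to a vertex of the other; (3) $K_4$; (4) $K_{1,1,3}$ (two adjacent vertices $x,y$ and three further vertices each adjacent to both $x$ and $y$).
   Context: A clause is a disjunction of literals (Boolean variables or their negations); a reduced 2-CNF is a conjunction of clauses each consisting of exactly two literals on two distinct variables, with no repeated clause. With $|x|=|\neg x|=x$, the associated multigraph of such a CNF has as vertices the variables occurring in it and one edge $\{|a|,|b|\}$ per clause $(a\vee b)$; the CNF is simple if this has no multiple edges, in which case the graph is denoted $\mathcal{G}(S)$. $\mathcal{U}$ is the family of graphs $\mathcal{G}(S)$ with $S$ an unsatisfiable simple 2-CNF. A graph $G$ is a topological minor of $H$ if some subdivision of $G$ is isomorphic to a subgraph of $H$. A graph $G$ is a minimal unsatisfiability graph if $G\in\mathcal{U}$ and no proper topological minor of $G$ is in $\mathcal{U}$. -}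

module Defs where

open import Data.Nat using (ℕ; suc)
open import Data.Fin using (Fin; zero; suc; _≟_)
open import Data.Bool using (Bool; true; false; _∧_; _∨_; not; T)
open import Data.Bool.Properties using (∨-comm; ∧-comm)
open import Data.Product using (Σ; ∃; _×_; _,_; proj₁; proj₂)
open import Data.Sum using (_⊎_)
open import Data.List using (List; []; _∷_; length; lookup)
open import Data.Bool.ListAction using (any)
open import Data.Fin using (#_)
open import Relation.Binary.PropositionalEquality
open import Data.Empty using (⊥-elim)
open import Relation.Nullary using (¬_; yes; no; does)
open import Function.Definitions using (Injective)

record Graph : Set where
  field
    n          : ℕ
    adj        : Fin n → Fin n → Bool
    adj-sym    : ∀ u v → adj u v ≡ adj v u
    adj-irrefl : ∀ u → adj u u ≡ false
open Graph public

record _≅_ (G H : Graph) : Set where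
  field
    to       : Fin (n G) → Fin (n H)
    from     : Fin (n H) → Fin (n G)
    from-to  : ∀ u → from (to u) ≡ u
    to-from  : ∀ v → to (from v) ≡ v
    preserve : ∀ u v → adj G u v ≡ adj H (to u) (to v)

IsoToSubgraph : Graph → Graph → Set
IsoToSubgraph G H =
  Σ (Fin (n G) → Fin (n H)) λ f →
    Injective _≡_ _≡_ f × (∀ u v → T (adj G u v) → T (adj H (f u) (f v)))

_==_ : ∀ {k} → Fin k → Fin k → Bool
a == b = does (a ≟ b)

==-sym : ∀ {k} (a b : Fin k) → (a == b) ≡ (b == a)
==-sym a b with a ≟ b | b ≟ a
... | yes _ | yes _ = refl
... | no _  | no _  = refl
... | yes p | no q  = ⊥-elim (q (sym p))
... | no p  | yes q = ⊥-elim (p (sym q))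

==-refl : ∀ {k} (a : Fin k) → (a == a) ≡ true
==-refl a with a ≟ a
... | yes _ = refl
... | no p  = ⊥-elim (p refl)

-- Subdividing the edge {u,v} of G: the new vertex is 'zero',
-- old vertex w becomes 'suc w'; the edge uv is replaced by the path u - new - v.
module _ (G : Graph) (u v : Fin (n G)) where
  private
    isuv : Fin (n G) → Fin (n G) → Bool
    isuv a b = ((a == u) ∧ (b == v)) ∨ ((a == v) ∧ (b == u))

    isuv-sym : ∀ a b → isuv a b ≡ isuv b a
    isuv-sym a b
      rewrite ∧-comm (a == u) (b == v) | ∧-comm (a == v) (b == u)
      = ∨-comm ((b == v) ∧ (a == u)) ((b == u) ∧ (a == v))

    sadj : Fin (suc (n G)) → Fin (suc (n G)) → Bool
    sadj zero    zero    = false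
    sadj zero    (suc w) = (w == u) ∨ (w == v)
    sadj (suc w) zero    = (w == u) ∨ (w == v)
    sadj (suc a) (suc b) = adj G a b ∧ not (isuv a b)

    sadj-sym : ∀ a b → sadj a b ≡ sadj b a
    sadj-sym zero    zero    = refl
    sadj-sym zero    (suc w) = refl
    sadj-sym (suc w) zero    = refl
    sadj-sym (suc a) (suc b) rewrite adj-sym G a b | isuv-sym a b = refl

    sadj-irrefl : ∀ a → sadj a a ≡ false
    sadj-irrefl zero    = refl
    sadj-irrefl (suc a) rewrite adj-irrefl G a = refl

  subdivideEdge : Graph
  subdivideEdge = record
    { n = suc (n G) ; adj = sadj ; adj-sym = sadj-sym ; adj-irrefl = sadj-irrefl }

data SubdivisionOf (G : Graph) : Graph → Set where
  base : SubdivisionOf G G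
  step : ∀ {K} → SubdivisionOf G K → (u v : Fin (n K)) → T (adj K u v) →
         SubdivisionOf G (subdivideEdge K u v)

TopologicalMinor : Graph → Graph → Set
TopologicalMinor G H = Σ Graph λ K → SubdivisionOf G K × IsoToSubgraph K H

-- a literal: a variable together with a polarity (true = positive, false = negated)
Literal : ℕ → Set
Literal m = Fin m × Bool

var : ∀ {m} → Literal m → Fin m
var = proj₁

record Clause (m : ℕ) : Set where
  constructor clause
  field
    lit₁ lit₂ : Literal m
    distinct  : ¬ (var lit₁ ≡ var lit₂)
open Clause public

CNF : ℕ → Set
CNF m = List (Clause m)

SameClause : ∀ {m} → Clause m → Clause m → Set
SameClause c d = (lit₁ c ≡ lit₁ d × lit₂ c ≡ lit₂ d) ⊎ (lit₁ c ≡ lit₂ d × lit₂ c ≡ lit₁ d)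

ClauseOn : ∀ {m} → Clause m → Fin m → Fin m → Set
ClauseOn c x y = (var (lit₁ c) ≡ x × var (lit₂ c) ≡ y) ⊎ (var (lit₁ c) ≡ y × var (lit₂ c) ≡ x)

Reduced : ∀ {m} → CNF m → Set
Reduced S = ∀ i j → ¬ (i ≡ j) → ¬ SameClause (lookup S i) (lookup S j)

Simple : ∀ {m} → CNF m → Set
Simple S = ∀ i j → ¬ (i ≡ j) →
  ¬ ClauseOn (lookup S j) (var (lit₁ (lookup S i))) (var (lit₂ (lookup S i)))

litValue : ∀ {m} → (Fin m → Bool) → Literal m → Bool
litValue α (x , true)  = α x
litValue α (x , false) = not (α x)

SatisfiesClause : ∀ {m} → (Fin m → Bool) → Clause m → Set
SatisfiesClause α c = T (litValue α (lit₁ c) ∨ litValue α (lit₂ c))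

Satisfiable : ∀ {m} → CNF m → Set
Satisfiable {m} S = Σ (Fin m → Bool) λ α → ∀ i → SatisfiesClause α (lookup S i)

Unsatisfiable : ∀ {m} → CNF m → Set
Unsatisfiable S = ¬ Satisfiable S

Occurs : ∀ {m} → CNF m → Fin m → Set
Occurs S x = ∃ λ i → (var (lit₁ (lookup S i)) ≡ x) ⊎ (var (lit₂ (lookup S i)) ≡ x)

-- G is isomorphic to 𝒢(S): the graph whose vertices are the variables
-- occurring in S, with an edge {|a|,|b|} for each clause (a ∨ b).
-- f is a bijection from V(G) onto the occurring variables preserving adjacency.
IsoToGraphOf : ∀ {m} → Graph → CNF m → Set
IsoToGraphOf {m} G S =
  Σ (Fin (n G) → Fin m) λ f →
    Injective _≡_ _≡_ f ×
    (∀ u → Occurs S (f u)) ×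
    (∀ x → Occurs S x → ∃ λ u → f u ≡ x) ×
    (∀ u v → (T (adj G u v) → ∃ λ i → ClauseOn (lookup S i) (f u) (f v)) ×
             ((∃ λ i → ClauseOn (lookup S i) (f u) (f v)) → T (adj G u v)))

InU : Graph → Set
InU G = Σ ℕ λ m → Σ (CNF m) λ S →
  Reduced S × Simple S × Unsatisfiable S × IsoToGraphOf G S

MinimalUnsatGraph : Graph → Set
MinimalUnsatGraph G =
  InU G × (∀ H → TopologicalMinor H G → ¬ (H ≅ G) → ¬ InU H)

module _ (k : ℕ) (es : List (Fin k × Fin k)) where
  private
    hasEdge : Fin k → Fin k → Bool
    hasEdge a b = any (λ e → (proj₁ e == a) ∧ (proj₂ e == b)) es

    eadj : Fin k → Fin k → Bool
    eadj a b = not (a == b) ∧ (hasEdge a b ∨ hasEdge b a)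

    eadj-sym : ∀ a b → eadj a b ≡ eadj b a
    eadj-sym a b rewrite ==-sym a b | ∨-comm (hasEdge a b) (hasEdge b a) = refl

    eadj-irrefl : ∀ a → eadj a a ≡ false
    eadj-irrefl a rewrite ==-refl a = refl

  fromEdges : Graph
  fromEdges = record { n = k ; adj = eadj ; adj-sym = eadj-sym ; adj-irrefl = eadj-irrefl }

twoTrianglesSharingVertex : Graph
twoTrianglesSharingVertex = fromEdges 5
  ((# 0 , # 1) ∷ (# 0 , # 2) ∷ (# 1 , # 2) ∷ (# 0 , # 3) ∷ (# 0 , # 4) ∷ (# 3 , # 4) ∷ [])

twoTrianglesJoinedByEdge : Graph
twoTrianglesJoinedByEdge = fromEdges 6
  ((# 0 , # 1) ∷ (# 0 , # 2) ∷ (# 1 , # 2) ∷ (# 3 , # 4) ∷ (# 3 , # 5) ∷ (# 4 , # 5) ∷ (# 2 , # 3) ∷ [])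

K4 : Graph
K4 = fromEdges 4
  ((# 0 , # 1) ∷ (# 0 , # 2) ∷ (# 0 , # 3) ∷ (# 1 , # 2) ∷ (# 1 , # 3) ∷ (# 2 , # 3) ∷ [])

K113 : Graph
K113 = fromEdges 5
  ((# 0 , # 1) ∷ (# 0 , # 2) ∷ (# 0 , # 3) ∷ (# 0 , # 4) ∷ (# 1 , # 2) ∷ (# 1 , # 3) ∷ (# 1 , # 4) ∷ [])

-- A simple 2-CNF on a graph is a signing of it: each edge ab carries the polarities p a b and
-- p b a of its two literals. So a graph in 𝒰 has an unsatisfiable signing, and by resolution on
-- the new vertex so does every subdivision of it. Let a subdivision K of some H ∈ 𝒰 embed in G.
-- Were an edge xy of G missed, the unsatisfiable signing of K would extend to one of G − xy;
-- hence if every G − xy is satisfiable under every signing, the embedding covers all edges of G.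
-- An inner vertex of a subdivided edge would then map to a vertex of G whose only neighbours are
-- two non-adjacent vertices; if G has no such vertex, K = H and, G having no isolated vertex,
-- the embedding is an isomorphism. For the four graphs every G − xy is a pseudoforest, a theta
-- graph possibly with a pendant edge, or K₂,₃. A pseudoforest is satisfied by giving each vertex
-- the polarity of its outgoing edge in an orientation of out-degree ≤ 1; thetas and K₂,₃ are
-- checked exhaustively.
module Submission where

open import Defs
open import Level using (0ℓ)
open import Data.Nat as ℕ using (ℕ)
open import Data.Fin using (Fin; zero; suc; _≟_)
open import Data.Fin.Patterns
open import Data.Fin.Properties using (any?; all?; suc-injective)
open import Data.Fin.Subset.Properties using (anySubset?)
open import Data.Bool using (Bool; true; false; _∧_; _∨_; not; T; if_then_else_)
open import Data.Bool.Properties using (T-∧; T-∨; ∨-comm)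
open import Data.Product as Product using (Σ; ∃; ∃₂; _×_; _,_; proj₁; proj₂)
open import Data.Product.Properties using (≡-dec)
open import Data.Sum as Sum using (_⊎_; inj₁; inj₂; [_,_]′; swap)
open import Data.Empty using (⊥; ⊥-elim)
open import Data.List as List using (List; []; _∷_; [_]; lookup; removeAt; cartesianProductWith)
open import Data.List.Membership.Propositional using (_∈_)
open import Data.List.Membership.Propositional.Properties using (∈-map⁻; ∈-cartesianProductWith⁺)
import Data.List.Membership.DecPropositional
open import Data.List.Relation.Unary.All as All using (All; []; _∷_)
open import Data.List.Relation.Unary.Any as Any using (here; there; index)
open import Data.List.Relation.Unary.Any.Properties using (any⁻)
open import Data.Vec as Vec using (Vec; []; _∷_)
open import Data.Vec.Properties using (lookup∘tabulate)
open import Function using (_∘_)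
open import Function.Bundles using (Equivalence)
open import Function.Definitions using (Injective)
open import Relation.Binary using (Rel)
open import Relation.Binary.PropositionalEquality
  using (_≡_; _≢_; refl; sym; trans; cong; cong₂; subst; subst₂)
open import Relation.Nullary using (¬_; yes; no; Dec; ¬?)
open import Relation.Nullary.Decidable
  using (_×-dec_; _⊎-dec_; _→-dec_; T?; map′; True; toWitness)

open Equivalence using (to; from)

private
  variable
    k m : ℕ

==⇒≡ : {a b : Fin k} → T (a == b) → a ≡ b
==⇒≡ {a = a} {b} t with a ≟ b
... | yes a≡b = a≡b

T-==-refl : (a : Fin k) → T (a == a)
T-==-refl a = subst T (sym (==-refl a)) _

≢⇒==false : {a b : Fin k} → a ≢ b → (a == b) ≡ false
≢⇒==false {a = a} {b} a≢b with a ≟ b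
... | yes a≡b = ⊥-elim (a≢b a≡b)
... | no _    = refl

¬T-not : ∀ {x} → T (not x) → ¬ T x
¬T-not {false} _ ()

¬T⇒T-not : ∀ {x} → ¬ T x → T (not x)
¬T⇒T-not {true}  ¬t = ¬t _
¬T⇒T-not {false} _  = _

T-injective : ∀ {x y} → (T x → T y) → (T y → T x) → x ≡ y
T-injective {false} {false} _   _   = refl
T-injective {false} {true}  _   y⇒x = ⊥-elim (y⇒x _)
T-injective {true}  {false} x⇒y _   = ⊥-elim (x⇒y _)
T-injective {true}  {true}  _   _   = refl

resolve : ∀ z {x y} → T (z ∨ x) → T (not z ∨ y) → T (x ∨ y)
resolve true  _  y = from T-∨ (inj₂ y)
resolve false x  _ = from T-∨ (inj₁ x)

module _ {A : Set} (g : Fin k → Fin m) where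

  extend : (Fin k → A) → A → Fin m → A
  extend h d x with any? (λ a → g a ≟ x)
  ... | yes (a , _) = h a
  ... | no _        = d

  extend-∘ : Injective _≡_ _≡_ g → ∀ h d a → extend h d (g a) ≡ h a
  extend-∘ g-inj h d a with any? (λ a′ → g a′ ≟ g a)
  ... | yes (a′ , ga′≡ga) = cong h (g-inj ga′≡ga)
  ... | no ∄a             = ⊥-elim (∄a (a , refl))

-- A record rather than a synonym for T (…), so that α, l and l′ can be inferred from it.
record Holds (α : Fin k → Bool) (l l′ : Literal k) : Set where
  constructor holds
  field satisfied : T (litValue α l ∨ litValue α l′)
open Holds

holds-swap : ∀ {α : Fin k → Bool} {l l′} → Holds α l l′ → Holds α l′ l
holds-swap {α = α} {l} {l′} (holds t) = holds (subst T (∨-comm (litValue α l) (litValue α l′)) t)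

litValue-cong : ∀ {α : Fin k → Bool} {β : Fin m → Bool} {x y} s →
                α x ≡ β y → litValue α (x , s) ≡ litValue β (y , s)
litValue-cong true  e = e
litValue-cong false e = cong not e

holds-cong : ∀ {α : Fin k → Bool} {β : Fin m → Bool} {x y x′ y′ s t} →
             α x ≡ β x′ → α y ≡ β y′ → Holds α (x , s) (y , t) → Holds β (x′ , s) (y′ , t)
holds-cong {s = s} {t} ex ey (holds h) =
  holds (subst₂ (λ a b → T (a ∨ b)) (litValue-cong s ex) (litValue-cong t ey) h)

-- p a b is the polarity of the literal on a in the clause of the edge ab.
Signing : ℕ → Set
Signing k = Fin k → Fin k → Bool

SignedClause : (Fin k → Bool) → Signing k → Fin k → Fin k → Set
SignedClause α p a b = Holds α (a , p a b) (b , p b a)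

SignedSat : Rel (Fin k) 0ℓ → Signing k → Set
SignedSat {k} E p = Σ (Fin k → Bool) λ α → ∀ {a b} → E a b → SignedClause α p a b

AlwaysSat : Rel (Fin k) 0ℓ → Set
AlwaysSat E = ∀ p → SignedSat E p

HasUnsatSigning : Rel (Fin k) 0ℓ → Set
HasUnsatSigning E = ∃ λ p → ¬ SignedSat E p

alwaysSat-⊆ : {E F : Rel (Fin k) 0ℓ} → (∀ {a b} → E a b → F a b ⊎ F b a) →
              AlwaysSat F → AlwaysSat E
alwaysSat-⊆ E⊆F F-sat p with F-sat p
... | α , sat = α , [ sat , holds-swap ∘ sat ]′ ∘ E⊆F

signedSat-pullback : {E : Rel (Fin k) 0ℓ} {F : Rel (Fin m) 0ℓ} {p : Signing m} {q : Signing k}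
                     (f : Fin k → Fin m) → (∀ a b → p (f a) (f b) ≡ q a b) →
                     (∀ {a b} → E a b → F (f a) (f b)) → SignedSat F p → SignedSat E q
signedSat-pullback {E = E} {p = p} {q} f p∘f≡q hom (α , sat) = α ∘ f , sat′
  where
  sat′ : ∀ {a b} → E a b → SignedClause (α ∘ f) q a b
  sat′ {a} {b} ab = subst₂ (λ s t → Holds (α ∘ f) (a , s) (b , t)) (p∘f≡q a b) (p∘f≡q b a)
                           (holds-cong refl refl (sat (hom ab)))

extendSigning : (f : Fin k → Fin m) → Signing k → Signing m
extendSigning f q x y = extend f (λ a → extend f (q a) true y) true x

extendSigning-∘ : ∀ {f : Fin k → Fin m} → Injective _≡_ _≡_ f →
                  ∀ q a b → extendSigning f q (f a) (f b) ≡ q a b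
extendSigning-∘ {f = f} f-inj q a b =
  trans (extend-∘ f f-inj (λ a → extend f (q a) true (f b)) true a) (extend-∘ f f-inj (q a) true b)

signedSat-pushforward : {E : Rel (Fin k) 0ℓ} {F : Rel (Fin m) 0ℓ} {p : Signing m}
                        (g : Fin k → Fin m) → Injective _≡_ _≡_ g →
                        (∀ {x y} → F x y → ∃₂ λ a b → g a ≡ x × g b ≡ y × E a b) →
                        SignedSat E (λ a b → p (g a) (g b)) → SignedSat F p
signedSat-pushforward {F = F} {p} g g-inj onto (γ , sat) = α , sat′
  where
  α = extend g γ false
  sat′ : ∀ {x y} → F x y → SignedClause α p x y
  sat′ xy with onto xy
  ... | a , b , refl , refl , ab =
    holds-cong (sym (extend-∘ g g-inj γ false a)) (sym (extend-∘ g g-inj γ false b)) (sat ab)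

Adj : (G : Graph) → Rel (Fin (n G)) 0ℓ
Adj G a b = T (adj G a b)

Adj-sym : ∀ G {a b} → Adj G a b → Adj G b a
Adj-sym G {a} {b} = subst T (adj-sym G a b)

Adj⇒≢ : ∀ G {a b} → Adj G a b → a ≢ b
Adj⇒≢ G ab refl = subst T (adj-irrefl G _) ab

clauseOn? : (c : Clause m) (x y : Fin m) → Dec (ClauseOn c x y)
clauseOn? c x y =
  (var (lit₁ c) ≟ x ×-dec var (lit₂ c) ≟ y) ⊎-dec (var (lit₁ c) ≟ y ×-dec var (lit₂ c) ≟ x)

clauseOn-sym : ∀ {c : Clause m} {x y} → ClauseOn c x y → ClauseOn c y x
clauseOn-sym = swap

clauseOn-trans : ∀ {c d : Clause m} {x y} → ClauseOn c x y → ClauseOn d x y →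
                 ClauseOn d (var (lit₁ c)) (var (lit₂ c))
clauseOn-trans (inj₁ (refl , refl)) on = on
clauseOn-trans {d = d} (inj₂ (refl , refl)) on = clauseOn-sym {c = d} on

polarityAt : Clause m → Fin m → Bool
polarityAt c x with var (lit₁ c) ≟ x
... | yes _ = proj₂ (lit₁ c)
... | no _  = proj₂ (lit₂ c)

polarityAt-lit₁ : ∀ (c : Clause m) → polarityAt c (var (lit₁ c)) ≡ proj₂ (lit₁ c)
polarityAt-lit₁ c with var (lit₁ c) ≟ var (lit₁ c)
... | yes _ = refl
... | no ≢  = ⊥-elim (≢ refl)

polarityAt-lit₂ : ∀ (c : Clause m) → polarityAt c (var (lit₂ c)) ≡ proj₂ (lit₂ c)
polarityAt-lit₂ c with var (lit₁ c) ≟ var (lit₂ c)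
... | yes ≡ = ⊥-elim (distinct c ≡)
... | no _  = refl

module _ (S : CNF m) (simple : Simple S) (f : Fin k → Fin m) where

  clauseOn-unique : ∀ {i j x y} → ClauseOn (lookup S i) x y → ClauseOn (lookup S j) x y → j ≡ i
  clauseOn-unique {i} {j} oni onj with i ≟ j
  ... | yes i≡j = sym i≡j
  ... | no i≢j  = ⊥-elim (simple i j i≢j (clauseOn-trans {c = lookup S i} {d = lookup S j} oni onj))

  -- Sign each edge uv as in the clause of S on {f u, f v}; the default is never used.
  signingOf : Signing k
  signingOf u v with any? (λ i → clauseOn? (lookup S i) (f u) (f v))
  ... | yes (i , _) = polarityAt (lookup S i) (f u)
  ... | no _        = true

  signingOf-clause : ∀ i {u v} → ClauseOn (lookup S i) (f u) (f v) →
                     signingOf u v ≡ polarityAt (lookup S i) (f u)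
  signingOf-clause i {u} {v} oni with any? (λ j → clauseOn? (lookup S j) (f u) (f v))
  ... | yes (j , onj) = cong (λ j → polarityAt (lookup S j) (f u)) (clauseOn-unique oni onj)
  ... | no ∄j         = ⊥-elim (∄j (i , oni))

inU⇒unsatSigning : ∀ G → InU G → HasUnsatSigning (Adj G)
inU⇒unsatSigning G (m , S , _ , simple , unsat , f , f-inj , _ , f-onto , f-adj) =
  p , λ (α , sat) → unsat (extend f α false , clause-holds α sat)
  where
  p = signingOf S simple f

  clause-holds : ∀ α → (∀ {a b} → Adj G a b → SignedClause α p a b) →
                 ∀ i → SatisfiesClause (extend f α false) (lookup S i)
  clause-holds α sat i with f-onto _ (i , inj₁ refl) | f-onto _ (i , inj₂ refl)
  ... | u , fu≡x₁ | v , fv≡x₂ =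
    satisfied (holds-cong (α≡β fu≡x₁) (α≡β fv≡x₂) (subst₂ (λ s t → Holds α (u , s) (v , t)) pu pv (sat uv)))
    where
    c = lookup S i
    on : ClauseOn c (f u) (f v)
    on = inj₁ (sym fu≡x₁ , sym fv≡x₂)
    uv : Adj G u v
    uv = proj₂ (f-adj u v) (i , on)
    pu : p u v ≡ proj₂ (lit₁ c)
    pu = trans (signingOf-clause S simple f i on) (trans (cong (polarityAt c) fu≡x₁) (polarityAt-lit₁ c))
    pv : p v u ≡ proj₂ (lit₂ c)
    pv = trans (signingOf-clause S simple f i (clauseOn-sym {c = c} on))
               (trans (cong (polarityAt c) fv≡x₂) (polarityAt-lit₂ c))
    α≡β : ∀ {w x} → f w ≡ x → α w ≡ extend f α false x
    α≡β {w} refl = sym (extend-∘ f f-inj α false w)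

SameEdge : Fin k → Fin k → Rel (Fin k) 0ℓ
SameEdge x y a b = (a ≡ x × b ≡ y) ⊎ (a ≡ y × b ≡ x)

sameEdge? : (x y a b : Fin k) → Dec (SameEdge x y a b)
sameEdge? x y a b = (a ≟ x ×-dec b ≟ y) ⊎-dec (a ≟ y ×-dec b ≟ x)

sameEdge-flip : ∀ {x y a b : Fin k} → SameEdge x y a b → SameEdge x y b a
sameEdge-flip = swap ∘ Sum.map Product.swap Product.swap

module SubdivideEdge (K : Graph) (u v : Fin (n K)) where

  subdivideEdge-new₁ : Adj (subdivideEdge K u v) zero (suc u)
  subdivideEdge-new₁ = from (T-∨ {u == u} {u == v}) (inj₁ (T-==-refl u))

  subdivideEdge-new₂ : Adj (subdivideEdge K u v) zero (suc v)
  subdivideEdge-new₂ = from (T-∨ {v == u} {v == v}) (inj₂ (T-==-refl v))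

  subdivideEdge-neighbours : ∀ {b} → Adj (subdivideEdge K u v) zero b → b ≡ suc u ⊎ b ≡ suc v
  subdivideEdge-neighbours {suc w} t =
    Sum.map (cong suc ∘ ==⇒≡) (cong suc ∘ ==⇒≡) (to (T-∨ {w == u} {w == v}) t)

  subdivideEdge-removed : ¬ Adj (subdivideEdge K u v) (suc u) (suc v)
  subdivideEdge-removed t = ¬T-not (proj₂ (to (T-∧ {adj K u v}) t))
    (from (T-∨ {(u == u) ∧ (v == v)}) (inj₁ (from (T-∧ {u == u} {v == v}) (T-==-refl u , T-==-refl v))))

  subdivideEdge-kept : ∀ {a b} → Adj K a b → ¬ SameEdge u v a b → Adj (subdivideEdge K u v) (suc a) (suc b)
  subdivideEdge-kept {a} {b} ab ¬same =
    from (T-∧ {adj K a b}) (ab , ¬T⇒T-not (¬same ∘ Sum.map ==⇒≡× ==⇒≡× ∘ split))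
    where
    split = to (T-∨ {(a == u) ∧ (b == v)} {(a == v) ∧ (b == u)})

    ==⇒≡× : ∀ {a b c d : Fin (n K)} → T ((a == b) ∧ (c == d)) → a ≡ b × c ≡ d
    ==⇒≡× {a} {b} {c} {d} t = let (ab , cd) = to (T-∧ {a == b} {c == d}) t in ==⇒≡ ab , ==⇒≡ cd

subdivideEdge-unsat : ∀ {K u v} → Adj K u v → HasUnsatSigning (Adj K) →
                      HasUnsatSigning (Adj (subdivideEdge K u v))
subdivideEdge-unsat {K} {u} {v} uv (p , unsat) = q , λ (β , sat) → unsat (β ∘ suc , sat′ β sat)
  where
  open SubdivideEdge K u v
  -- The new vertex occurs positively in the clause with u and negatively in the one with v.
  q : Signing (ℕ.suc (n K))
  q zero    zero    = true
  q zero    (suc w) = w == u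
  q (suc a) zero    = if a == u then p u v else p v u
  q (suc a) (suc b) = p a b

  module _ (β : Fin (ℕ.suc (n K)) → Bool)
           (sat : ∀ {a b} → Adj (subdivideEdge K u v) a b → SignedClause β q a b) where

    clause-u : T (β zero ∨ litValue β (suc u , p u v))
    clause-u = subst (λ s → T (litValue β (zero , s) ∨ litValue β (suc u , (if s then p u v else p v u))))
                     (==-refl u) (satisfied (sat {zero} {suc u} subdivideEdge-new₁))

    clause-v : T (not (β zero) ∨ litValue β (suc v , p v u))
    clause-v = subst (λ s → T (litValue β (zero , s) ∨ litValue β (suc v , (if s then p u v else p v u))))
                     (≢⇒==false (Adj⇒≢ K uv ∘ sym)) (satisfied (sat {zero} {suc v} subdivideEdge-new₂))

    resolvent : SignedClause (β ∘ suc) p u v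
    resolvent = holds-cong refl refl (holds (resolve (β zero) clause-u clause-v))

    sat′ : ∀ {a b} → Adj K a b → SignedClause (β ∘ suc) p a b
    sat′ {a} {b} ab with sameEdge? u v a b
    ... | yes (inj₁ (refl , refl)) = resolvent
    ... | yes (inj₂ (refl , refl)) = holds-swap resolvent
    ... | no ¬same                 = holds-cong refl refl (sat (subdivideEdge-kept ab ¬same))

subdivision-unsat : ∀ {H K} → SubdivisionOf H K → HasUnsatSigning (Adj H) → HasUnsatSigning (Adj K)
subdivision-unsat base            = λ unsat → unsat
subdivision-unsat (step s _ _ uv) = subdivideEdge-unsat uv ∘ subdivision-unsat s

DeletionsAlwaysSat : Graph → Set
DeletionsAlwaysSat G = ∀ {x y} → Adj G x y → AlwaysSat (λ a b → Adj G a b × ¬ SameEdge x y a b)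

NoIsolatedVertex : Graph → Set
NoIsolatedVertex G = ∀ x → ∃ λ y → Adj G x y

-- A vertex is suppressible if it has exactly two neighbours and they are non-adjacent.
NoSuppressibleVertex : Graph → Set
NoSuppressibleVertex G = ∀ w x y → Adj G w x → Adj G w y → x ≢ y → ¬ Adj G x y →
                         ∃ λ z → Adj G w z × z ≢ x × z ≢ y

module Embedding {K G : Graph} (f : Fin (n K) → Fin (n G)) (f-inj : Injective _≡_ _≡_ f)
                 (f-adj : ∀ u v → Adj K u v → Adj G (f u) (f v)) where

  ImageEdge : Rel (Fin (n G)) 0ℓ
  ImageEdge x y = ∃₂ λ a b → f a ≡ x × f b ≡ y × Adj K a b

  imageEdge? : ∀ x y → Dec (ImageEdge x y)
  imageEdge? x y = any? λ a → any? λ b → f a ≟ x ×-dec f b ≟ y ×-dec T? (adj K a b)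

  CoversEdges : Set
  CoversEdges = ∀ {x y} → Adj G x y → ImageEdge x y

  covers-edges : DeletionsAlwaysSat G → HasUnsatSigning (Adj K) → CoversEdges
  covers-edges deletions (q , unsat) {x} {y} xy with imageEdge? x y
  ... | yes image = image
  ... | no ¬image =
    ⊥-elim (unsat (signedSat-pullback f (extendSigning-∘ f-inj q) avoids
                                      (deletions xy (extendSigning f q))))
    where
    avoids : ∀ {a b} → Adj K a b → Adj G (f a) (f b) × ¬ SameEdge x y (f a) (f b)
    avoids ab = f-adj _ _ ab , λ where
      (inj₁ (refl , refl)) → ¬image (_ , _ , refl , refl , ab)
      (inj₂ (refl , refl)) → ¬image (_ , _ , refl , refl , Adj-sym K ab)

  reflect-adj : CoversEdges → ∀ {u v} → Adj G (f u) (f v) → Adj K u v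
  reflect-adj covers fufv with covers fufv
  ... | a , b , fa≡fu , fb≡fv , ab with f-inj fa≡fu | f-inj fb≡fv
  ... | refl | refl = ab

  covering⇒≅ : NoIsolatedVertex G → CoversEdges → K ≅ G
  covering⇒≅ no-isolated covers = record
    { to       = f
    ; from     = preimage
    ; from-to  = λ u → f-inj (f-preimage (f u))
    ; to-from  = f-preimage
    ; preserve = λ u v → T-injective (f-adj u v) (reflect-adj covers)
    }
    where
    preimage : Fin (n G) → Fin (n K)
    preimage x = proj₁ (covers (proj₂ (no-isolated x)))

    f-preimage : ∀ x → f (preimage x) ≡ x
    f-preimage x = proj₁ (proj₂ (proj₂ (covers (proj₂ (no-isolated x)))))

  suppressible⇒⊥ : NoSuppressibleVertex G → CoversEdges → ∀ {w x y} → Adj K w x → Adj K w y → x ≢ y →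
                   ¬ Adj K x y → (∀ {b} → Adj K w b → b ≡ x ⊎ b ≡ y) → ⊥
  suppressible⇒⊥ no-suppressible covers {w} {x} {y} wx wy x≢y ¬xy neighbours
    with no-suppressible (f w) (f x) (f y) (f-adj _ _ wx) (f-adj _ _ wy) (x≢y ∘ f-inj) (¬xy ∘ reflect-adj covers)
  ... | z , fwz , z≢fx , z≢fy with covers fwz
  ... | a , b , fa≡fw , refl , ab with f-inj fa≡fw
  ... | refl = [ z≢fx ∘ cong f , z≢fy ∘ cong f ]′ (neighbours ab)

minimalUnsatGraph : ∀ {G} → InU G → DeletionsAlwaysSat G → NoIsolatedVertex G →
                    NoSuppressibleVertex G → MinimalUnsatGraph G
minimalUnsatGraph {G} G∈U deletions no-isolated no-suppressible = G∈U , no-proper-minor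
  where
  no-proper-minor : ∀ H → TopologicalMinor H G → ¬ (H ≅ G) → ¬ InU H
  no-proper-minor H (_ , base , f , f-inj , f-adj) H≇G H∈U =
    H≇G (covering⇒≅ no-isolated (covers-edges deletions (inU⇒unsatSigning H H∈U)))
    where open Embedding {G = G} f f-inj f-adj
  no-proper-minor H (_ , step {K} sub u v uv , f , f-inj , f-adj) H≇G H∈U =
    suppressible⇒⊥ no-suppressible covers {zero} subdivideEdge-new₁ subdivideEdge-new₂
                   (Adj⇒≢ K uv ∘ suc-injective) subdivideEdge-removed subdivideEdge-neighbours
    where
    open SubdivideEdge K u v
    open Embedding {K = subdivideEdge K u v} {G = G} f f-inj f-adj
    covers : CoversEdges
    covers =
      covers-edges deletions (subdivideEdge-unsat uv (subdivision-unsat sub (inU⇒unsatSigning H H∈U)))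

Edges : List (Fin k × Fin k) → Rel (Fin k) 0ℓ
Edges es a b = (a , b) ∈ es

∈-removeAt : ∀ {A : Set} {x y : A} {xs} (x∈xs : x ∈ xs) → y ∈ xs → y ≢ x → y ∈ removeAt xs (index x∈xs)
∈-removeAt (here refl)  (here refl)  y≢x = ⊥-elim (y≢x refl)
∈-removeAt (here refl)  (there y∈xs) _   = y∈xs
∈-removeAt (there x∈xs) (here refl)  _   = here refl
∈-removeAt (there x∈xs) (there y∈xs) y≢x = there (∈-removeAt x∈xs y∈xs y≢x)

fromEdges-adj⇒∈ : ∀ {es : List (Fin k × Fin k)} {a b} → Adj (fromEdges k es) a b →
                  (a , b) ∈ es ⊎ (b , a) ∈ es
fromEdges-adj⇒∈ {k} {es} {a} {b} t =
  Sum.map (Any.map (edge a b) ∘ any⁻ _ es) (Any.map (edge b a) ∘ any⁻ _ es)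
          (to T-∨ (proj₂ (to (T-∧ {not (a == b)}) t)))
  where
  edge : ∀ x y {e : Fin k × Fin k} → T ((proj₁ e == x) ∧ (proj₂ e == y)) → (x , y) ≡ e
  edge x y {e} t = let (ex , ey) = to (T-∧ {proj₁ e == x}) t in cong₂ _,_ (sym (==⇒≡ ex)) (sym (==⇒≡ ey))

deletionsAlwaysSat-fromEdges : ∀ {es : List (Fin k × Fin k)} →
                               (∀ i → AlwaysSat (Edges (removeAt es i))) → DeletionsAlwaysSat (fromEdges k es)
deletionsAlwaysSat-fromEdges {k} {es} deletion-sat {x} {y} xy =
  [ delete (λ { refl → inj₁ (refl , refl) }) , delete (λ { refl → inj₂ (refl , refl) }) ]′ (fromEdges-adj⇒∈ xy)
  where
  delete : ∀ {e} → (∀ {a b} → (a , b) ≡ e → SameEdge x y a b) → e ∈ es →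
           AlwaysSat (λ a b → Adj (fromEdges k es) a b × ¬ SameEdge x y a b)
  delete same e∈es = alwaysSat-⊆ kept (deletion-sat (index e∈es))
    where
    kept : ∀ {a b} → Adj (fromEdges k es) a b × ¬ SameEdge x y a b →
           Edges (removeAt es (index e∈es)) a b ⊎ Edges (removeAt es (index e∈es)) b a
    kept (ab , ¬same) = Sum.map (λ ab∈es → ∈-removeAt e∈es ab∈es (¬same ∘ same))
                                (λ ba∈es → ∈-removeAt e∈es ba∈es (¬same ∘ sameEdge-flip ∘ same))
                                (fromEdges-adj⇒∈ ab)

simple⇒reduced : ∀ {S : CNF m} → Simple S → Reduced S
simple⇒reduced {S = S} simple i j i≢j same = simple i j i≢j (clauseOn same)
  where
  clauseOn : SameClause (lookup S i) (lookup S j) →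
             ClauseOn (lookup S j) (var (lit₁ (lookup S i))) (var (lit₂ (lookup S i)))
  clauseOn (inj₁ (e₁ , e₂)) = inj₁ (cong proj₁ (sym e₁) , cong proj₁ (sym e₂))
  clauseOn (inj₂ (e₁ , e₂)) = inj₂ (cong proj₁ (sym e₂) , cong proj₁ (sym e₁))

satisfiesClause-cong : ∀ {α β : Fin m → Bool} {c} → (∀ x → α x ≡ β x) →
                       SatisfiesClause α c → SatisfiesClause β c
satisfiesClause-cong {c = clause (x , s) (y , t) _} α≗β sat =
  satisfied (holds-cong {x = x} {y} {x} {y} {s} {t} (α≗β x) (α≗β y) (holds sat))

simple? : (S : CNF m) → Dec (Simple S)
simple? S = all? λ i → all? λ j → ¬? (i ≟ j) →-dec ¬? (clauseOn? (lookup S j) _ _)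

unsatisfiable? : (S : CNF m) → Dec (Unsatisfiable S)
unsatisfiable? S = ¬? (map′ (λ (v , sat) → Vec.lookup v , sat) (λ (α , sat) → Vec.tabulate α , tabulated α sat)
                            (anySubset? λ v → all? λ i → T? _))
  where
  tabulated : ∀ α → (∀ i → SatisfiesClause α (lookup S i)) →
              ∀ i → SatisfiesClause (Vec.lookup (Vec.tabulate α)) (lookup S i)
  tabulated α sat i = satisfiesClause-cong {c = lookup S i} (λ x → sym (lookup∘tabulate α x)) (sat i)

-- 𝒢(S) is G itself: the variables of S are the vertices of G.
GraphOf : ∀ G → CNF (n G) → Set
GraphOf G S = (∀ u → Occurs S u) ×
              (∀ u v → (Adj G u v → ∃ λ i → ClauseOn (lookup S i) u v) ×
                       ((∃ λ i → ClauseOn (lookup S i) u v) → Adj G u v))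

graphOf? : ∀ G (S : CNF (n G)) → Dec (GraphOf G S)
graphOf? G S =
  (all? λ u → any? λ i → var (lit₁ (lookup S i)) ≟ u ⊎-dec var (lit₂ (lookup S i)) ≟ u) ×-dec
  (all? λ u → all? λ v → (T? (adj G u v) →-dec clauseOnSome u v) ×-dec (clauseOnSome u v →-dec T? (adj G u v)))
  where
  clauseOnSome : ∀ u v → Dec (∃ λ i → ClauseOn (lookup S i) u v)
  clauseOnSome u v = any? λ i → clauseOn? (lookup S i) u v

inU-by-cnf : ∀ G (S : CNF (n G)) → Simple S → Unsatisfiable S → GraphOf G S → InU G
inU-by-cnf G S simple unsat (occurs , edges) =
  n G , S , simple⇒reduced {S = S} simple , simple , unsat ,
  (λ u → u) , (λ e → e) , occurs , (λ x _ → x , refl) , edges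

noIsolatedVertex? : ∀ G → Dec (NoIsolatedVertex G)
noIsolatedVertex? G = all? λ x → any? λ y → T? (adj G x y)

noSuppressibleVertex? : ∀ G → Dec (NoSuppressibleVertex G)
noSuppressibleVertex? G = all? λ w → all? λ x → all? λ y →
  T? (adj G w x) →-dec T? (adj G w y) →-dec ¬? (x ≟ y) →-dec ¬? (T? (adj G x y)) →-dec
  any? λ z → T? (adj G w z) ×-dec ¬? (z ≟ x) ×-dec ¬? (z ≟ y)

fromEdges-minimal : ∀ (es : List (Fin k × Fin k)) (S : CNF k) →
                    {simple : True (simple? S)} {unsat : True (unsatisfiable? S)}
                    {graphOf : True (graphOf? (fromEdges k es) S)} →
                    {no-isolated : True (noIsolatedVertex? (fromEdges k es))}
                    {no-suppressible : True (noSuppressibleVertex? (fromEdges k es))} →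
                    (∀ i → AlwaysSat (Edges (removeAt es i))) → MinimalUnsatGraph (fromEdges k es)
fromEdges-minimal {k} es S {simple} {unsat} {graphOf} {no-isolated} {no-suppressible} deletions =
  minimalUnsatGraph (inU-by-cnf (fromEdges k es) S (toWitness simple) (toWitness unsat) (toWitness graphOf))
                    (deletionsAlwaysSat-fromEdges {es = es} deletions)
                    (toWitness no-isolated) (toWitness no-suppressible)

litValue-self : ∀ (α : Fin k → Bool) x → T (litValue α (x , α x))
litValue-self α x with α x in αx
... | true  = subst T (sym αx) _
... | false = subst (T ∘ not) (sym αx) _

Oriented : (Fin k → Fin k) → Fin k × Fin k → Set
Oriented out (a , b) = out a ≡ b ⊎ out b ≡ a

oriented? : (out : Fin k → Fin k) (e : Fin k × Fin k) → Dec (Oriented out e)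
oriented? out (a , b) = out a ≟ b ⊎-dec out b ≟ a

-- An orientation with out-degree at most one exists exactly on pseudoforests.
pseudoforest⇒alwaysSat : ∀ {E : Rel (Fin k) 0ℓ} (out : Fin k → Fin k) →
                         (∀ {a b} → E a b → Oriented out (a , b)) → AlwaysSat E
pseudoforest⇒alwaysSat {E = E} out oriented p = α , sat
  where
  α : Fin _ → Bool
  α a = p a (out a)
  sat : ∀ {a b} → E a b → SignedClause α p a b
  sat {a} {b} ab with oriented ab
  ... | inj₁ refl = holds (from (T-∨ {litValue α (a , p a b)}) (inj₁ (litValue-self α a)))
  ... | inj₂ refl = holds (from (T-∨ {litValue α (a , p a b)}) (inj₂ (litValue-self α b)))

pseudoforest-alwaysSat : ∀ {es : List (Fin k × Fin k)} (out : Vec (Fin k) k)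
                         {oriented : True (All.all? (oriented? (Vec.lookup out)) es)} → AlwaysSat (Edges es)
pseudoforest-alwaysSat out {oriented} =
  pseudoforest⇒alwaysSat (Vec.lookup out) (All.lookup (toWitness oriented))

Avoids : Fin k → Fin k × Fin k → Set
Avoids v (a , b) = a ≢ v × b ≢ v

avoids? : (v : Fin k) (e : Fin k × Fin k) → Dec (Avoids v e)
avoids? v (a , b) = ¬? (a ≟ v) ×-dec ¬? (b ≟ v)

alwaysSat-pendant : ∀ {es : List (Fin k × Fin k)} v w {fresh : True (All.all? (avoids? v) es)} →
                    AlwaysSat (Edges es) → AlwaysSat (Edges ((v , w) ∷ es))
alwaysSat-pendant {es = es} v w {fresh} es-sat p with es-sat p
... | α , sat = α′ , sat′
  where
  α′ : Fin _ → Bool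
  α′ x with x ≟ v
  ... | yes _ = p v w
  ... | no _  = α x

  α′-v : α′ v ≡ p v w
  α′-v with v ≟ v
  ... | yes _ = refl
  ... | no v≢v = ⊥-elim (v≢v refl)

  α′-off : ∀ {x} → x ≢ v → α x ≡ α′ x
  α′-off {x} x≢v with x ≟ v
  ... | yes x≡v = ⊥-elim (x≢v x≡v)
  ... | no _    = refl

  sat′ : ∀ {a b} → Edges ((v , w) ∷ es) a b → SignedClause α′ p a b
  sat′ (here refl) = holds (from (T-∨ {litValue α′ (v , p v w)})
                                 (inj₁ (subst (λ s → T (litValue α′ (v , s))) α′-v (litValue-self α′ v))))
  sat′ (there ab) with All.lookup (toWitness fresh) ab
  ... | a≢v , b≢v = holds-cong (α′-off a≢v) (α′-off b≢v) (sat ab)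

alwaysSat-relabel : ∀ {es : List (Fin k × Fin k)} (g : Fin k → Fin m) → Injective _≡_ _≡_ g →
                    AlwaysSat (Edges es) → AlwaysSat (Edges (List.map (Product.map g g) es))
alwaysSat-relabel {es = es} g g-inj es-sat p =
  signedSat-pushforward g g-inj onto (es-sat (λ a b → p (g a) (g b)))
  where
  onto : ∀ {x y} → Edges (List.map (Product.map g g) es) x y →
         ∃₂ λ a b → g a ≡ x × g b ≡ y × Edges es a b
  onto xy with ∈-map⁻ (Product.map g g) xy
  ... | (a , b) , ab , refl = a , b , refl , refl , ab

Covered : List (Fin k × Fin k) → Fin k × Fin k → Set
Covered es (a , b) = (a , b) ∈ es ⊎ (b , a) ∈ es

covered? : (es : List (Fin k × Fin k)) (e : Fin k × Fin k) → Dec (Covered es e)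
covered? es (a , b) = (a , b) ∈? es ⊎-dec (b , a) ∈? es
  where open Data.List.Membership.DecPropositional (≡-dec _≟_ _≟_)

alwaysSat-sublist : ∀ {es es′ : List (Fin k × Fin k)} {covered : True (All.all? (covered? es′) es)} →
                    AlwaysSat (Edges es′) → AlwaysSat (Edges es)
alwaysSat-sublist {covered = covered} = alwaysSat-⊆ (All.lookup (toWitness covered))

injective? : (g : Fin k → Fin m) → Dec (Injective _≡_ _≡_ g)
injective? g = map′ (λ inj {x} {y} → inj x y) (λ inj x y → inj)
                    (all? λ x → all? λ y → g x ≟ g y →-dec x ≟ y)

polarities : List (Bool × Bool)
polarities = (true , true) ∷ (true , false) ∷ (false , true) ∷ (false , false) ∷ []

∈-polarities : ∀ st → st ∈ polarities
∈-polarities (true  , true)  = here refl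
∈-polarities (true  , false) = there (here refl)
∈-polarities (false , true)  = there (there (here refl))
∈-polarities (false , false) = there (there (there (here refl)))

SignedEdges : ℕ → Set
SignedEdges k = List (Literal k × Literal k)

signEdge : Fin k × Fin k → Bool × Bool → SignedEdges k → SignedEdges k
signEdge (a , b) (s , t) cs = ((a , s) , (b , t)) ∷ cs

signings : List (Fin k × Fin k) → List (SignedEdges k)
signings []       = [ [] ]
signings (e ∷ es) = cartesianProductWith (signEdge e) polarities (signings es)

signed : Signing k → List (Fin k × Fin k) → SignedEdges k
signed p []             = []
signed p ((a , b) ∷ es) = signEdge (a , b) (p a b , p b a) (signed p es)

signed-∈-signings : ∀ p (es : List (Fin k × Fin k)) → signed p es ∈ signings es
signed-∈-signings p []             = here refl
signed-∈-signings p ((a , b) ∷ es) =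
  ∈-cartesianProductWith⁺ (signEdge (a , b)) (∈-polarities (p a b , p b a)) (signed-∈-signings p es)

signed-holds : ∀ {α : Fin k → Bool} {p} {es : List (Fin k × Fin k)} →
               All (λ (l , l′) → Holds α l l′) (signed p es) → ∀ {a b} → Edges es a b → SignedClause α p a b
signed-holds {es = _ ∷ _} (h ∷ _) (here refl) = h
signed-holds {es = _ ∷ _} (_ ∷ hs) (there ab) = signed-holds hs ab

SatisfiableEdges : SignedEdges k → Set
SatisfiableEdges {k} cs = ∃ λ (v : Vec Bool k) → All (λ (l , l′) → Holds (Vec.lookup v) l l′) cs

satisfiableEdges? : (cs : SignedEdges k) → Dec (SatisfiableEdges cs)
satisfiableEdges? cs = anySubset? λ v → All.all? (λ (l , l′) → map′ holds satisfied (T? _)) cs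

alwaysSat-by-enumeration : ∀ {es : List (Fin k × Fin k)}
                           {all-sat : True (All.all? satisfiableEdges? (signings es))} → AlwaysSat (Edges es)
alwaysSat-by-enumeration {es = es} {all-sat} p with All.lookup (toWitness all-sat) (signed-∈-signings p es)
... | v , sat = Vec.lookup v , signed-holds sat

-- Branch vertices a, b joined by the paths ab, acb and adb: K₄ minus the edge cd.
theta : (a b c d : Fin k) → List (Fin k × Fin k)
theta a b c d = (a , b) ∷ (a , c) ∷ (b , c) ∷ (a , d) ∷ (b , d) ∷ []

theta-alwaysSat : ∀ (a b c d : Fin k) {distinct : True (injective? (Vec.lookup (a ∷ b ∷ c ∷ d ∷ [])))} →
                  AlwaysSat (Edges (theta a b c d))
theta-alwaysSat a b c d {distinct} =
  alwaysSat-relabel _ (toWitness distinct) (alwaysSat-by-enumeration {es = theta {4} 0F 1F 2F 3F})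

twoTrianglesSharingVertex-minimal : MinimalUnsatGraph twoTrianglesSharingVertex
twoTrianglesSharingVertex-minimal = fromEdges-minimal edges cnf deletions
  where
  edges : List (Fin 5 × Fin 5)
  edges = (0F , 1F) ∷ (0F , 2F) ∷ (1F , 2F) ∷ (0F , 3F) ∷ (0F , 4F) ∷ (3F , 4F) ∷ []

  cnf : CNF 5
  cnf = clause (0F , false) (1F , false) (λ ()) ∷ clause (0F , false) (2F , false) (λ ())
      ∷ clause (1F , true)  (2F , true)  (λ ()) ∷ clause (0F , true)  (3F , false) (λ ())
      ∷ clause (0F , true)  (4F , false) (λ ()) ∷ clause (3F , true)  (4F , true)  (λ ()) ∷ []

  deletions : ∀ i → AlwaysSat (Edges (removeAt edges i))
  deletions 0F = pseudoforest-alwaysSat (3F ∷ 2F ∷ 0F ∷ 4F ∷ 0F ∷ [])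
  deletions 1F = pseudoforest-alwaysSat (3F ∷ 0F ∷ 1F ∷ 4F ∷ 0F ∷ [])
  deletions 2F = pseudoforest-alwaysSat (3F ∷ 0F ∷ 0F ∷ 4F ∷ 0F ∷ [])
  deletions 3F = pseudoforest-alwaysSat (1F ∷ 2F ∷ 0F ∷ 4F ∷ 0F ∷ [])
  deletions 4F = pseudoforest-alwaysSat (1F ∷ 2F ∷ 0F ∷ 0F ∷ 3F ∷ [])
  deletions 5F = pseudoforest-alwaysSat (1F ∷ 2F ∷ 0F ∷ 0F ∷ 0F ∷ [])

twoTrianglesJoinedByEdge-minimal : MinimalUnsatGraph twoTrianglesJoinedByEdge
twoTrianglesJoinedByEdge-minimal = fromEdges-minimal edges cnf deletions
  where
  edges : List (Fin 6 × Fin 6)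
  edges = (0F , 1F) ∷ (0F , 2F) ∷ (1F , 2F) ∷ (3F , 4F) ∷ (3F , 5F) ∷ (4F , 5F) ∷ (2F , 3F) ∷ []

  cnf : CNF 6
  cnf = clause (0F , false) (1F , false) (λ ()) ∷ clause (0F , true)  (2F , false) (λ ())
      ∷ clause (1F , true)  (2F , false) (λ ()) ∷ clause (3F , false) (4F , false) (λ ())
      ∷ clause (3F , false) (5F , false) (λ ()) ∷ clause (4F , true)  (5F , true)  (λ ())
      ∷ clause (2F , true)  (3F , true)  (λ ()) ∷ []

  deletions : ∀ i → AlwaysSat (Edges (removeAt edges i))
  deletions 0F = pseudoforest-alwaysSat (2F ∷ 2F ∷ 3F ∷ 4F ∷ 5F ∷ 3F ∷ [])
  deletions 1F = pseudoforest-alwaysSat (1F ∷ 2F ∷ 3F ∷ 4F ∷ 5F ∷ 3F ∷ [])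
  deletions 2F = pseudoforest-alwaysSat (2F ∷ 0F ∷ 3F ∷ 4F ∷ 5F ∷ 3F ∷ [])
  deletions 3F = pseudoforest-alwaysSat (1F ∷ 2F ∷ 0F ∷ 2F ∷ 5F ∷ 3F ∷ [])
  deletions 4F = pseudoforest-alwaysSat (1F ∷ 2F ∷ 0F ∷ 2F ∷ 3F ∷ 4F ∷ [])
  deletions 5F = pseudoforest-alwaysSat (1F ∷ 2F ∷ 0F ∷ 2F ∷ 3F ∷ 3F ∷ [])
  deletions 6F = pseudoforest-alwaysSat (1F ∷ 2F ∷ 0F ∷ 4F ∷ 5F ∷ 3F ∷ [])

K4-minimal : MinimalUnsatGraph K4
K4-minimal = fromEdges-minimal edges cnf deletions
  where
  edges : List (Fin 4 × Fin 4)
  edges = (0F , 1F) ∷ (0F , 2F) ∷ (0F , 3F) ∷ (1F , 2F) ∷ (1F , 3F) ∷ (2F , 3F) ∷ []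

  cnf : CNF 4
  cnf = clause (0F , false) (1F , false) (λ ()) ∷ clause (0F , false) (2F , false) (λ ())
      ∷ clause (0F , true)  (3F , false) (λ ()) ∷ clause (1F , true)  (2F , true)  (λ ())
      ∷ clause (1F , false) (3F , true)  (λ ()) ∷ clause (2F , false) (3F , true)  (λ ()) ∷ []

  deletions : ∀ i → AlwaysSat (Edges (removeAt edges i))
  deletions 0F = alwaysSat-sublist (theta-alwaysSat 2F 3F 0F 1F)
  deletions 1F = alwaysSat-sublist (theta-alwaysSat 1F 3F 0F 2F)
  deletions 2F = alwaysSat-sublist (theta-alwaysSat 1F 2F 0F 3F)
  deletions 3F = alwaysSat-sublist (theta-alwaysSat 0F 3F 1F 2F)
  deletions 4F = alwaysSat-sublist (theta-alwaysSat 0F 2F 1F 3F)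
  deletions 5F = alwaysSat-sublist (theta-alwaysSat 0F 1F 2F 3F)

K113-minimal : MinimalUnsatGraph K113
K113-minimal = fromEdges-minimal edges cnf deletions
  where
  edges : List (Fin 5 × Fin 5)
  edges = (0F , 1F) ∷ (0F , 2F) ∷ (0F , 3F) ∷ (0F , 4F) ∷ (1F , 2F) ∷ (1F , 3F) ∷ (1F , 4F) ∷ []

  cnf : CNF 5
  cnf = clause (0F , false) (1F , false) (λ ()) ∷ clause (0F , false) (2F , false) (λ ())
      ∷ clause (0F , true)  (3F , false) (λ ()) ∷ clause (0F , true)  (4F , false) (λ ())
      ∷ clause (1F , true)  (2F , true)  (λ ()) ∷ clause (1F , false) (3F , true)  (λ ())
      ∷ clause (1F , true)  (4F , true)  (λ ()) ∷ []

  deletions : ∀ i → AlwaysSat (Edges (removeAt edges i))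
  deletions 0F = alwaysSat-by-enumeration -- K₂,₃
  deletions 1F = alwaysSat-sublist (alwaysSat-pendant 2F 1F (theta-alwaysSat 0F 1F 3F 4F))
  deletions 2F = alwaysSat-sublist (alwaysSat-pendant 3F 1F (theta-alwaysSat 0F 1F 2F 4F))
  deletions 3F = alwaysSat-sublist (alwaysSat-pendant 4F 1F (theta-alwaysSat 0F 1F 2F 3F))
  deletions 4F = alwaysSat-sublist (alwaysSat-pendant 2F 0F (theta-alwaysSat 0F 1F 3F 4F))
  deletions 5F = alwaysSat-sublist (alwaysSat-pendant 3F 0F (theta-alwaysSat 0F 1F 2F 4F))
  deletions 6F = alwaysSat-sublist (alwaysSat-pendant 4F 0F (theta-alwaysSat 0F 1F 2F 3F))

lemma16 : MinimalUnsatGraph twoTrianglesSharingVertex ×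
          MinimalUnsatGraph twoTrianglesJoinedByEdge ×
          MinimalUnsatGraph K4 ×
          MinimalUnsatGraph K113
lemma16 = twoTrianglesSharingVertex-minimal , twoTrianglesJoinedByEdge-minimal , K4-minimal , K113-minimal
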